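{- Let $\mathcal{V}$ be a variety of groups, let $A$ be a group in $\mathcal{V}$ and $S\subseteq A$. Then for any graph $G$, there exists a homomorphism of $G$ to $\mathrm{Cay}(A,S)$ if and only if there exists a homomorphism of $\mathrm{Cay}(\mathcal{F}_{\mathcal V}(G),S_{\mathcal V}(G))$ to $\mathrm{Cay}(A,S)$.
   Context: A variety of groups is a class of groups defined by a set of equations (identities). For a graph $G$, $\mathcal{F}_{\mathcal V}(G)$ denotes the free group in the variety $\mathcal V$ on the vertex set $V(G)$, and $S_{\mathcal V}(G)=\{u^{ -1}v : \{u,v\}\in E(G)\}\subseteq \mathcal{F}_{\mathcal V}(G)$. For a group $B$ and $T\subseteq B$, the Cayley graph $\mathrm{Cay}(B,T)$ has vertex set $B$, and $\{w_1,w_2\}$ is an edge when $w_1^{ -1}w_2\in T$. A graph homomorphism is a map of vertex sets sending edges to edges. -}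

module Defs where

open import Level using (Level; _⊔_; suc; zero)
open import Data.Nat using (ℕ)
open import Data.Product using (Σ; ∃; _×_; _,_)
open import Data.Sum using (_⊎_)
open import Relation.Nullary using (¬_)
open import Relation.Binary.PropositionalEquality using (_≡_)
open import Algebra.Bundles using (Group)
open import Algebra.Structures using (IsGroup; IsMonoid; IsSemigroup; IsMagma)

private variable
  a c ℓ ℓ′ s v e t : Level

data Word (X : Set a) : Set a where
  var : X → Word X
  unit : Word X
  _·_ : Word X → Word X → Word X
  inv : Word X → Word X

subst : {X : Set a} → (ℕ → Word X) → Word ℕ → Word X
subst σ (var n) = σ n
subst σ unit = unit
subst σ (w · w′) = subst σ w · subst σ w′
subst σ (inv w) = inv (subst σ w)

-- A variety of groups is given by a set of identities s = t
-- (s, t words in countably many variables x₀, x₁, …).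
Variety : Set₁
Variety = Word ℕ → Word ℕ → Set

eval : {X : Set a} (A : Group c ℓ) → (X → Group.Carrier A) → Word X → Group.Carrier A
eval A ρ (var x) = ρ x
eval A ρ unit = Group.ε A
eval A ρ (w · w′) = Group._∙_ A (eval A ρ w) (eval A ρ w′)
eval A ρ (inv w) = Group._⁻¹ A (eval A ρ w)

InVariety : Variety → Group c ℓ → Set (c ⊔ ℓ)
InVariety 𝒱 A = ∀ s t → 𝒱 s t → (ρ : ℕ → Group.Carrier A) →
  Group._≈_ A (eval A ρ s) (eval A ρ t)

data _⊢_∼_ {X : Set a} (𝒱 : Variety) : Word X → Word X → Set a where
  ∼-refl  : ∀ {w} → 𝒱 ⊢ w ∼ w
  ∼-sym   : ∀ {w w′} → 𝒱 ⊢ w ∼ w′ → 𝒱 ⊢ w′ ∼ w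
  ∼-trans : ∀ {w w′ w″} → 𝒱 ⊢ w ∼ w′ → 𝒱 ⊢ w′ ∼ w″ → 𝒱 ⊢ w ∼ w″
  ·-cong  : ∀ {w₁ w₂ w₃ w₄} → 𝒱 ⊢ w₁ ∼ w₂ → 𝒱 ⊢ w₃ ∼ w₄ → 𝒱 ⊢ (w₁ · w₃) ∼ (w₂ · w₄)
  inv-cong : ∀ {w w′} → 𝒱 ⊢ w ∼ w′ → 𝒱 ⊢ inv w ∼ inv w′
  assoc   : ∀ w₁ w₂ w₃ → 𝒱 ⊢ ((w₁ · w₂) · w₃) ∼ (w₁ · (w₂ · w₃))
  idˡ     : ∀ w → 𝒱 ⊢ (unit · w) ∼ w
  idʳ     : ∀ w → 𝒱 ⊢ (w · unit) ∼ w
  invˡ    : ∀ w → 𝒱 ⊢ (inv w · w) ∼ unit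
  invʳ    : ∀ w → 𝒱 ⊢ (w · inv w) ∼ unit
  law     : ∀ {s t} → 𝒱 s t → (σ : ℕ → Word X) → 𝒱 ⊢ subst σ s ∼ subst σ t

FreeV : Variety → (X : Set a) → Group a a
FreeV 𝒱 X = record
  { Carrier = Word X
  ; _≈_ = 𝒱 ⊢_∼_
  ; _∙_ = _·_
  ; ε = unit
  ; _⁻¹ = inv
  ; isGroup = record
    { isMonoid = record
      { isSemigroup = record
        { isMagma = record
          { isEquivalence = record { refl = ∼-refl ; sym = ∼-sym ; trans = ∼-trans }
          ; ∙-cong = ·-cong }
        ; assoc = assoc }
      ; identity = idˡ , idʳ }
    ; inverse = invˡ , invʳ
    ; ⁻¹-cong = inv-cong }
  }

record Graph (v e : Level) : Set (suc (v ⊔ e)) where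
  field
    V : Set v
    E : V → V → Set e
    E-sym : ∀ {x y} → E x y → E y x
    E-irrefl : ∀ {x} → ¬ E x x

-- Edge relation of the Cayley graph Cay(B,T): {w₁,w₂} is an edge when
-- w₁⁻¹w₂ ∈ T (edges are unordered, so either orientation).
CayEdge : (B : Group c ℓ) → (Group.Carrier B → Set t) →
          Group.Carrier B → Group.Carrier B → Set t
CayEdge B T w₁ w₂ = T (w₁ ⁻¹ ∙ w₂) ⊎ T (w₂ ⁻¹ ∙ w₁)
  where open Group B

-- S_𝒱(G) = { u⁻¹v : {u,v} ∈ E(G) } ⊆ 𝓕_𝒱(G) (membership up to equality in 𝓕_𝒱(G)).
S𝒱 : (𝒱 : Variety) (G : Graph v e) → Group.Carrier (FreeV 𝒱 (Graph.V G)) → Set (v ⊔ e)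
S𝒱 𝒱 G w = ∃ λ u → ∃ λ u′ → E u u′ × (𝒱 ⊢ w ∼ (inv (var u) · var u′))
  where open Graph G

GraphHomToCay : (G : Graph v e) (A : Group c ℓ) → (Group.Carrier A → Set s) → Set (v ⊔ e ⊔ c ⊔ s)
GraphHomToCay G A S =
  Σ (Graph.V G → Group.Carrier A) λ f →
    ∀ {x y} → Graph.E G x y → CayEdge A S (f x) (f y)

-- A graph homomorphism Cay(B,T) → Cay(A,S); vertex maps are maps of the
-- underlying sets (so must respect the setoid equalities).
CayHom : (B : Group a ℓ′) → (Group.Carrier B → Set t) →
         (A : Group c ℓ) → (Group.Carrier A → Set s) → Set _
CayHom B T A S =
  Σ (Group.Carrier B → Group.Carrier A) λ f →
    (∀ {x y} → Group._≈_ B x y → Group._≈_ A (f x) (f y)) ×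
    (∀ {x y} → CayEdge B T x y → CayEdge A S (f x) (f y))

module Submission where

-- A map f : V(G) → A extends uniquely to a group homomorphism
-- 𝓕_𝒱(G) → A, namely evaluation of words under f; it is well defined on
-- 𝓕_𝒱(G) exactly because A satisfies the identities of 𝒱 (lemma
-- eval-respects-∼).  Whether {x,y} is an edge of a Cayley graph depends
-- only on the "difference" x⁻¹y (lemma CayEdge-by-difference), and the
-- evaluation map sends u⁻¹v to f(u)⁻¹f(v).  Hence every graph homomorphism
-- G → Cay(A,S) extends to a homomorphism Cay(𝓕_𝒱(G),S_𝒱(G)) → Cay(A,S)
-- (extend-to-free).  Conversely G embeds in Cay(𝓕_𝒱(G),S_𝒱(G)) via
-- u ↦ u, so composing restricts such a homomorphism back to G
-- (restrict-to-generators).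

open import Defs
open import Level using (Level)
open import Algebra.Bundles using (Group)
open import Function.Bundles using (_⇔_; mk⇔)
open import Data.Nat using (ℕ)
open import Data.Product using (_,_)
open import Data.Sum using (inj₁; inj₂; swap)
import Algebra.Properties.Group as GroupProperties
import Relation.Binary.Reasoning.Setoid as SetoidReasoning

module _ {c ℓ : Level} (A : Group c ℓ) where
  open Group A
  open GroupProperties A using (⁻¹-anti-homo-\\)

  eval-subst : ∀ {a} {X : Set a} (ρ : X → Carrier) (σ : ℕ → Word X) (w : Word ℕ) →
    eval A ρ (subst σ w) ≈ eval A (λ n → eval A ρ (σ n)) w
  eval-subst ρ σ (var n) = refl
  eval-subst ρ σ unit = refl
  eval-subst ρ σ (w · w′) = ∙-cong (eval-subst ρ σ w) (eval-subst ρ σ w′)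
  eval-subst ρ σ (inv w) = ⁻¹-cong (eval-subst ρ σ w)

  eval-respects-∼ : ∀ {a} {X : Set a} (𝒱 : Variety) → InVariety 𝒱 A →
    (ρ : X → Carrier) → ∀ {w w′} → 𝒱 ⊢ w ∼ w′ → eval A ρ w ≈ eval A ρ w′
  eval-respects-∼ 𝒱 A∈𝒱 ρ = go
    where
    go : ∀ {w w′} → 𝒱 ⊢ w ∼ w′ → eval A ρ w ≈ eval A ρ w′
    go ∼-refl = refl
    go (∼-sym p) = sym (go p)
    go (∼-trans p q) = trans (go p) (go q)
    go (·-cong p q) = ∙-cong (go p) (go q)
    go (inv-cong p) = ⁻¹-cong (go p)
    go (_⊢_∼_.assoc _ _ _) = Group.assoc A _ _ _
    go (idˡ _) = identityˡ _
    go (idʳ _) = identityʳ _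
    go (invˡ _) = inverseˡ _
    go (invʳ _) = inverseʳ _
    go (law {s} {t} s=t σ) = begin
      eval A ρ (subst σ s)              ≈⟨ eval-subst ρ σ s ⟩
      eval A (λ n → eval A ρ (σ n)) s   ≈⟨ A∈𝒱 s t s=t _ ⟩
      eval A (λ n → eval A ρ (σ n)) t   ≈⟨ eval-subst ρ σ t ⟨
      eval A ρ (subst σ t)              ∎
      where open SetoidReasoning setoid

  CayEdge-by-difference : ∀ {s} (S : Carrier → Set s) → (∀ {x y} → x ≈ y → S x → S y) →
    ∀ {x y p q} → x \\ y ≈ p \\ q → CayEdge A S p q → CayEdge A S x y
  CayEdge-by-difference S S-resp x\\y≈p\\q (inj₁ p\\q∈S) = inj₁ (S-resp (sym x\\y≈p\\q) p\\q∈S)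
  CayEdge-by-difference S S-resp {x} {y} {p} {q} x\\y≈p\\q (inj₂ q\\p∈S) =
    inj₂ (S-resp q\\p≈y\\x q\\p∈S)
    where
    -- Inverting both sides of x⁻¹y ≈ p⁻¹q.
    q\\p≈y\\x : q \\ p ≈ y \\ x
    q\\p≈y\\x = trans (sym (⁻¹-anti-homo-\\ p q))
                  (trans (⁻¹-cong (sym x\\y≈p\\q)) (⁻¹-anti-homo-\\ x y))

module _ {c ℓ s v e : Level} (𝒱 : Variety) (G : Graph v e) (A : Group c ℓ)
         (S : Group.Carrier A → Set s) where
  open Graph G

  extend-to-free : InVariety 𝒱 A → (∀ {x y} → Group._≈_ A x y → S x → S y) →
    GraphHomToCay G A S → CayHom (FreeV 𝒱 V) (S𝒱 𝒱 G) A S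
  extend-to-free A∈𝒱 S-resp (f , f-edge) = eval A f , eval-respects-∼ A 𝒱 A∈𝒱 f , edge
    where
    edge : ∀ {x y} → CayEdge (FreeV 𝒱 V) (S𝒱 𝒱 G) x y → CayEdge A S (eval A f x) (eval A f y)
    edge (inj₁ (u , u′ , uu′ , y\\x=u\\u′)) =
      CayEdge-by-difference A S S-resp (eval-respects-∼ A 𝒱 A∈𝒱 f y\\x=u\\u′) (f-edge uu′)
    edge (inj₂ (u , u′ , uu′ , x\\y=u\\u′)) =
      swap (CayEdge-by-difference A S S-resp (eval-respects-∼ A 𝒱 A∈𝒱 f x\\y=u\\u′) (f-edge uu′))

  restrict-to-generators : CayHom (FreeV 𝒱 V) (S𝒱 𝒱 G) A S → GraphHomToCay G A S
  restrict-to-generators (F , _ , F-edge) =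
    (λ u → F (var u)) , λ {u} {u′} uu′ → F-edge (inj₁ (u , u′ , uu′ , ∼-refl))

lemma9 : ∀ {c ℓ s v e : Level} (𝒱 : Variety) (A : Group c ℓ) → InVariety 𝒱 A →
         (S : Group.Carrier A → Set s) →
         (∀ {x y} → Group._≈_ A x y → S x → S y) →
         (G : Graph v e) →
         GraphHomToCay G A S ⇔ CayHom (FreeV 𝒱 (Graph.V G)) (S𝒱 𝒱 G) A S
lemma9 𝒱 A A∈𝒱 S S-resp G =
  mk⇔ (extend-to-free 𝒱 G A S A∈𝒱 S-resp) (restrict-to-generators 𝒱 G A S)
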